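{- Let $\mathscr{A} = (Q,\Sigma,\delta)$ be an aperiodically $1$-contracting DFA with $n$ states. Suppose there exists an efficient $1$-contracting collection $W\subseteq \Sigma^\star$ for which the induced state map $\sigma_W$ is a cyclic permutation on $Q$. Then: (1) the shortest synchronizing word of $\mathscr{A}$ has length at most $(n-1)^2$; (2) for every nonempty set $S\subseteq Q$ of size $k$, there exists a word $w_S$ of length at most $n(n-k)$ such that $\delta(Q,w_S)=S$.
   Context: A DFA is $\mathscr{A}=(Q,\Sigma,\delta)$ with finite state set $Q$, finite alphabet $\Sigma$ and transition function $\delta:Q\times\Sigma\to Q$, extended to $Q\times\Sigma^\star$ in the usual way, and to subsets by $\delta(S,w)=\{\delta(q,w)\mid q\in S\}$. A word $w$ is synchronizing if $\delta(Q,w)$ is a singleton. For $q\in Q$, $w\in\Sigma^\star$, $\delta^{ -1}(q,w)=\{p\in Q\mid\delta(p,w)=q\}$. A word $w$ is a $1$-deficient word excluding $q$ if $\delta(Q,w)=Q\setminus\{q\}$; it then has exactly one state $q^c$ with $|\delta^{ -1}(q^c,w)|=2$, its contracting state. A collection $W\subseteq\Sigma^\star$ is a $1$-contracting collection if for every $q\in Q$ it contains exactly one $1$-deficient word excluding $q$; it is efficient if moreover $|w|\le n$ for all $w\in W$. $\mathscr{A}$ is $1$-contracting if a $1$-contracting collection exists. The state map $\sigma_W:Q\to Q$ sends $q$ to the contracting state of the unique word of $W$ excluding $q$. $\mathscr{A}$ is aperiodically $1$-contracting if there is a $1$-contracting collection $W$ with $\sigma_W$ a cyclic permutation of $Q$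 (a single $n$-cycle). -}

module Defs where

open import Data.Nat using (ℕ; zero; suc; _≤_; _<_; _∸_; _*_; _^_)
open import Data.Fin using (Fin)
open import Data.Fin.Subset using (Subset; _∈_; ∣_∣)
open import Data.Fin.Properties using (_≟_)
open import Data.List using (List; []; _∷_; length; filter; allFin)
open import Data.Product using (Σ; ∃; ∃-syntax; _×_; _,_)
open import Relation.Binary.PropositionalEquality using (_≡_; _≢_)
open import Function using (_∘_)

record DFA (n m : ℕ) : Set where
  field
    δ : Fin n → Fin m → Fin n

Word : ℕ → Set
Word m = List (Fin m)

module _ {n m : ℕ} (A : DFA n m) where
  open DFA A

  δ* : Fin n → Word m → Fin n
  δ* q []       = q
  δ* q (a ∷ w)  = δ* (δ q a) w

  InImage : Word m → Fin n → Set
  InImage w q = ∃[ p ] δ* p w ≡ q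

  ImageIs : Word m → Subset n → Set
  ImageIs w S = ∀ q → (InImage w q → q ∈ S) × (q ∈ S → InImage w q)

  Synchronizing : Word m → Set
  Synchronizing w = ∃[ q ] (∀ p → δ* p w ≡ q)

  preimageCount : Word m → Fin n → ℕ
  preimageCount w q = length (filter (λ p → δ* p w ≟ q) (allFin n))

  OneDeficientExcluding : Word m → Fin n → Set
  OneDeficientExcluding w q = ∀ p → (InImage w p → p ≢ q) × (p ≢ q → InImage w p)

  ContractingState : Word m → Fin n → Set
  ContractingState w c = preimageCount w c ≡ 2

  -- A 1-contracting collection, presented as the family q ↦ (the word of W excluding q).
  OneContractingCollection : (Fin n → Word m) → Set
  OneContractingCollection W = ∀ q → OneDeficientExcluding (W q) q

  Efficient : (Fin n → Word m) → Set
  Efficient W = ∀ q → length (W q) ≤ n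

  IsStateMap : (Fin n → Word m) → (Fin n → Fin n) → Set
  IsStateMap W σ = ∀ q → ContractingState (W q) (σ q)

iterate : ∀ {n} → (Fin n → Fin n) → ℕ → Fin n → Fin n
iterate σ zero    q = q
iterate σ (suc k) q = σ (iterate σ k q)

-- σ is a single n-cycle: every state reaches every other state under iteration of σ
-- (on a finite set this forces σ to be a cyclic permutation).
IsCyclicPermutation : ∀ {n} → (Fin n → Fin n) → Set
IsCyclicPermutation σ = ∀ p q → ∃[ k ] iterate σ k p ≡ q

module Submission where

-- Write [u]p for the state reached from p by reading u.  For a word w and a set
-- S of states, the preimage T = {p | [w]p ∈ S} satisfies δ(Q, u w) = S as soon as
-- δ(Q, u) = T and S ⊆ δ(Q, w).  If S ≠ Q is nonempty, cyclicity of σ gives a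
-- state q ∉ S with σ q ∈ S; the word W q of the collection then covers S (it only
-- misses q) and has two preimages of σ q, so by double counting |T| ≥ |S| + 1.
-- Iterating this extension step, a nonempty S with n ≤ |S| + d is the image of a
-- word of length ≤ n·d, which is claim (2).  For claim (1), a contracting word
-- merges two distinct states, so some single letter a already merges two distinct
-- states x, y; the set {x, y} is the image of a word u of length ≤ n(n − 2), and
-- u a is synchronizing, of length ≤ n(n − 2) + 1 = (n − 1)².

open import Defs
open import Data.Bool using (true; false; if_then_else_)
open import Data.Nat using (ℕ; zero; suc; _+_; _≤_; _<_; _∸_; _*_; _^_; z≤n; s≤s; s≤s⁻¹)
open import Data.Nat.Properties
open import Algebra.Properties.Semiring.Sum +-*-semiring
  using (sum; sum-syntax; sum-cong-≗; sum-replicate-zero; ∑-comm; *-distribʳ-sum)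
open import Data.Fin using (Fin; zero; suc)
open import Data.Fin.Properties using (all?; ¬∀⟶∃¬) renaming (_≟_ to _≟F_; suc-injective to fsuc-injective)
open import Data.Fin.Subset using (Subset; ∣_∣; _∈_; _∉_; _⊂_; _∪_; ⁅_⁆; Nonempty)
open import Data.Fin.Subset.Properties
  using (_∈?_; nonempty?; Empty-unique; ∣⊥∣≡0; ∣⊤∣≡n; ∈⊤; ∣p∣≤n; p⊂q⇒∣p∣<∣q∣; x∈⁅x⁆; x∈⁅y⁆⇒x≡y; ∣⁅x⁆∣≡1; p⊆p∪q; q⊆p∪q; x∈p∪q⁻)
open import Data.Vec using (lookup; tabulate) renaming ([] to []ᵥ; _∷_ to _∷ᵥ_)
open import Data.Vec.Properties using (lookup∘tabulate; []=⇒lookup; lookup⇒[]=)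
open import Data.List using ([]; _∷_; length; filter; _++_)
import Data.List as List
open import Data.List.Properties using (length-++)
open import Data.Product using (∃; ∃₂; ∃-syntax; _×_; _,_; proj₁; proj₂)
open import Data.Sum using (_⊎_; inj₁; inj₂)
open import Relation.Nullary using (Dec; yes; no; does; contradiction)
open import Relation.Unary using (Pred; Decidable)
open import Relation.Binary.PropositionalEquality
open import Function using (_∘_)
open import Data.Nat.Solver using (module +-*-Solver)

𝟙 : ∀ {p} {P : Set p} → Dec P → ℕ
𝟙 P? = if does P? then 1 else 0

𝟙-cong : ∀ {p q} {P : Set p} {Q : Set q} → (P → Q) → (Q → P) →
         (P? : Dec P) (Q? : Dec Q) → 𝟙 P? ≡ 𝟙 Q?
𝟙-cong P→Q Q→P (yes _) (yes _) = refl
𝟙-cong P→Q Q→P (yes p) (no ¬q) = contradiction (P→Q p) ¬q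
𝟙-cong P→Q Q→P (no ¬p) (yes q) = contradiction (Q→P q) ¬p
𝟙-cong P→Q Q→P (no _)  (no _)  = refl

count : ∀ {n p} {P : Pred (Fin n) p} → Decidable P → ℕ
count {n} P? = ∑[ i < n ] 𝟙 (P? i)

sum-mono-≤ : ∀ {n} {f g : Fin n → ℕ} → (∀ i → f i ≤ g i) → sum f ≤ sum g
sum-mono-≤ {zero}  f≤g = z≤n
sum-mono-≤ {suc n} f≤g = +-mono-≤ (f≤g zero) (sum-mono-≤ (f≤g ∘ suc))

sum-mono-< : ∀ {n} {f g : Fin n → ℕ} → (∀ i → f i ≤ g i) → ∀ j → f j < g j → sum f < sum g
sum-mono-< f≤g zero    fj<gj = +-mono-<-≤ fj<gj (sum-mono-≤ (f≤g ∘ suc))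
sum-mono-< f≤g (suc j) fj<gj = +-mono-≤-< (f≤g zero) (sum-mono-< (f≤g ∘ suc) j fj<gj)

term≤sum : ∀ {n} (f : Fin n → ℕ) i → f i ≤ sum f
term≤sum f zero    = m≤m+n (f zero) _
term≤sum f (suc i) = ≤-trans (term≤sum (f ∘ suc) i) (m≤n+m _ (f zero))

sum-indicator : ∀ {n} (x : Fin n) (f : Fin n → ℕ) → ∑[ s < n ] (𝟙 (x ≟F s) * f s) ≡ f x
sum-indicator {suc n} zero f = begin
  f zero + 0 + sum {n} (λ _ → 0)  ≡⟨ cong (f zero + 0 +_) (sum-replicate-zero n) ⟩
  f zero + 0 + 0                  ≡⟨ +-identityʳ _ ⟩
  f zero + 0                      ≡⟨ +-identityʳ _ ⟩
  f zero                          ∎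
  where open ≡-Reasoning
sum-indicator {suc n} (suc x) f = sum-indicator x (f ∘ suc)

count-witness : ∀ {n p} {P : Pred (Fin n) p} (P? : Decidable P) → 1 ≤ count P? → ∃ P
count-witness {suc n} P? h with P? zero
... | yes p₀ = zero , p₀
... | no _   = let (x , px) = count-witness (P? ∘ suc) h in suc x , px

count-two-witnesses : ∀ {n p} {P : Pred (Fin n) p} (P? : Decidable P) → 2 ≤ count P? →
                      ∃₂ λ x y → x ≢ y × P x × P y
count-two-witnesses {suc n} P? h with P? zero
... | yes p₀ = let (y , py) = count-witness (P? ∘ suc) (s≤s⁻¹ h) in zero , suc y , (λ ()) , p₀ , py
... | no _   = let (x , y , x≢y , px , py) = count-two-witnesses (P? ∘ suc) h
               in suc x , suc y , x≢y ∘ fsuc-injective , px , py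

length-filter-tabulate : ∀ {n a p} {A : Set a} {P : Pred A p} (P? : Decidable P) (f : Fin n → A) →
                         length (filter P? (List.tabulate f)) ≡ count (P? ∘ f)
length-filter-tabulate {zero}  P? f = refl
length-filter-tabulate {suc n} P? f with P? (f zero)
... | yes _ = cong suc (length-filter-tabulate P? (f ∘ suc))
... | no _  = length-filter-tabulate P? (f ∘ suc)

∣∣≡count : ∀ {n} (S : Subset n) → ∣ S ∣ ≡ count (_∈? S)
∣∣≡count []ᵥ          = refl
∣∣≡count (true ∷ᵥ S)  = cong suc (∣∣≡count S)
∣∣≡count (false ∷ᵥ S) = ∣∣≡count S

preimage : ∀ {m n} → (Fin m → Fin n) → Subset n → Subset m
preimage g S = tabulate (λ p → lookup S (g p))

module _ {m n} {g : Fin m → Fin n} {S : Subset n} {p : Fin m} where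

  ∈-preimage⁺ : g p ∈ S → p ∈ preimage g S
  ∈-preimage⁺ gp∈S = lookup⇒[]= p _ (trans (lookup∘tabulate _ p) ([]=⇒lookup gp∈S))

  ∈-preimage⁻ : p ∈ preimage g S → g p ∈ S
  ∈-preimage⁻ p∈T = lookup⇒[]= (g p) S (trans (sym (lookup∘tabulate _ p)) ([]=⇒lookup p∈T))

fibre : ∀ {m n} → (Fin m → Fin n) → Fin n → ℕ
fibre g s = count (λ p → g p ≟F s)

fibre-inhabited : ∀ {m n} (g : Fin m → Fin n) {p s} → g p ≡ s → 1 ≤ fibre g s
fibre-inhabited g {p} {s} gp≡s = ≤-trans (hit (g p ≟F s)) (term≤sum (λ p′ → 𝟙 (g p′ ≟F s)) p)
  where
  hit : (d : Dec (g p ≡ s)) → 1 ≤ 𝟙 d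
  hit (yes _)     = s≤s z≤n
  hit (no gp≢s)   = contradiction gp≡s gp≢s

∣preimage∣≡sum-fibres : ∀ {m n} (g : Fin m → Fin n) (S : Subset n) →
                        ∣ preimage g S ∣ ≡ ∑[ s < n ] (fibre g s * 𝟙 (s ∈? S))
∣preimage∣≡sum-fibres {m} {n} g S = begin
  ∣ preimage g S ∣
    ≡⟨ ∣∣≡count (preimage g S) ⟩
  count (_∈? preimage g S)
    ≡⟨ sum-cong-≗ (λ p → 𝟙-cong ∈-preimage⁻ ∈-preimage⁺ (p ∈? preimage g S) (g p ∈? S)) ⟩
  ∑[ p < m ] 𝟙 (g p ∈? S)
    ≡⟨ sum-cong-≗ (λ p → sym (sum-indicator (g p) (λ s → 𝟙 (s ∈? S)))) ⟩
  ∑[ p < m ] ∑[ s < n ] (𝟙 (g p ≟F s) * 𝟙 (s ∈? S))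
    ≡⟨ ∑-comm (λ p s → 𝟙 (g p ≟F s) * 𝟙 (s ∈? S)) ⟩
  ∑[ s < n ] ∑[ p < m ] (𝟙 (g p ≟F s) * 𝟙 (s ∈? S))
    ≡⟨ sum-cong-≗ (λ s → sym (*-distribʳ-sum (𝟙 (s ∈? S)) (λ p → 𝟙 (g p ≟F s)))) ⟩
  ∑[ s < n ] (fibre g s * 𝟙 (s ∈? S))
    ∎
  where open ≡-Reasoning

preimage-grows : ∀ {m n} (g : Fin m → Fin n) (S : Subset n) →
                 (∀ {s} → s ∈ S → ∃ λ p → g p ≡ s) → ∀ {s₀} → s₀ ∈ S → 2 ≤ fibre g s₀ →
                 ∣ S ∣ < ∣ preimage g S ∣
preimage-grows {n = n} g S covered {s₀} s₀∈S two≤fibre =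
  subst₂ _<_ (sym (∣∣≡count S)) (sym (∣preimage∣≡sum-fibres g S))
    (sum-mono-< single-cover s₀ double-cover)
  where
  single-cover : ∀ s → 𝟙 (s ∈? S) ≤ fibre g s * 𝟙 (s ∈? S)
  single-cover s with s ∈? S
  ... | yes s∈S = ≤-trans (fibre-inhabited g (proj₂ (covered s∈S))) (≤-reflexive (sym (*-identityʳ _)))
  ... | no _    = z≤n

  double-cover : 𝟙 (s₀ ∈? S) < fibre g s₀ * 𝟙 (s₀ ∈? S)
  double-cover with s₀ ∈? S
  ... | yes _    = ≤-trans two≤fibre (≤-reflexive (sym (*-identityʳ _)))
  ... | no s₀∉S  = contradiction s₀∈S s₀∉S

∣∣<n : ∀ {n} {S : Subset n} {q} → q ∉ S → ∣ S ∣ < n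
∣∣<n {n} {S} {q} q∉S = subst (∣ S ∣ <_) (∣⊤∣≡n n) (p⊂q⇒∣p∣<∣q∣ ((λ _ → ∈⊤) , q , ∈⊤ , q∉S))

∣∣>0⇒nonempty : ∀ {n} (S : Subset n) → 1 ≤ ∣ S ∣ → Nonempty S
∣∣>0⇒nonempty {n} S 1≤∣S∣ with nonempty? S
... | yes ne   = ne
... | no empty = contradiction (trans (cong ∣_∣ (Empty-unique empty)) (∣⊥∣≡0 n)) (m<n⇒n≢0 1≤∣S∣)

2≤∣pair∣ : ∀ {n} {x y : Fin n} → x ≢ y → 2 ≤ ∣ ⁅ x ⁆ ∪ ⁅ y ⁆ ∣
2≤∣pair∣ {x = x} {y} x≢y = subst (_< ∣ ⁅ x ⁆ ∪ ⁅ y ⁆ ∣) (∣⁅x⁆∣≡1 x) (p⊂q⇒∣p∣<∣q∣ ⁅x⁆⊂pair)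
  where
  ⁅x⁆⊂pair : ⁅ x ⁆ ⊂ ⁅ x ⁆ ∪ ⁅ y ⁆
  ⁅x⁆⊂pair = p⊆p∪q ⁅ y ⁆ , y , q⊆p∪q ⁅ x ⁆ ⁅ y ⁆ (x∈⁅x⁆ y) , x≢y ∘ sym ∘ x∈⁅y⁆⇒x≡y x

exit-point : ∀ {n} (σ : Fin n → Fin n) (S : Subset n) {p} k →
             p ∉ S → iterate σ k p ∈ S → ∃ λ q → q ∉ S × σ q ∈ S
exit-point σ S zero    p∉S p∈S = contradiction p∈S p∉S
exit-point σ S {p} (suc k) p∉S σᵏ⁺¹p∈S with iterate σ k p ∈? S
... | yes σᵏp∈S = exit-point σ S k p∉S σᵏp∈S
... | no σᵏp∉S  = iterate σ k p , σᵏp∉S , σᵏ⁺¹p∈S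

module Words {n m} (A : DFA n m) where
  open DFA A

  run : Word m → Fin n → Fin n
  run w p = δ* A p w

  run-++ : ∀ u v p → run (u ++ v) p ≡ run v (run u p)
  run-++ []      v p = refl
  run-++ (a ∷ u) v p = run-++ u v (δ p a)

  image-[] : ∀ {S} → (∀ q → q ∈ S) → ImageIs A [] S
  image-[] full q = (λ _ → full q) , (λ _ → q , refl)

  image-++ : ∀ u w {S} → ImageIs A u (preimage (run w) S) → (∀ {s} → s ∈ S → InImage A w s) →
             ImageIs A (u ++ w) S
  image-++ u w {S} image-u covered q = into , onto
    where
    into : InImage A (u ++ w) q → q ∈ S
    into (p , reaches-q) = subst (_∈ S) (trans (sym (run-++ u w p)) reaches-q)
      (∈-preimage⁻ (proj₁ (image-u (run u p)) (p , refl)))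

    onto : q ∈ S → InImage A (u ++ w) q
    onto q∈S with covered q∈S
    ... | r , r↦q with proj₂ (image-u r) (∈-preimage⁺ (subst (_∈ S) (sym r↦q) q∈S))
    ... | p , p↦r = p , trans (run-++ u w p) (trans (cong (run w) p↦r) r↦q)

  merging-letter : ∀ w {x y} → x ≢ y → run w x ≡ run w y →
                   ∃ λ a → ∃₂ λ x′ y′ → x′ ≢ y′ × δ x′ a ≡ δ y′ a
  merging-letter []      x≢y x≡y = contradiction x≡y x≢y
  merging-letter (b ∷ w) {x} {y} x≢y merged with δ x b ≟F δ y b
  ... | yes δxb≡δyb = b , x , y , x≢y , δxb≡δyb
  ... | no δxb≢δyb  = merging-letter w δxb≢δyb merged

  synchronize-pair : ∀ u {a x y} → ImageIs A u (⁅ x ⁆ ∪ ⁅ y ⁆) → δ x a ≡ δ y a →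
                     Synchronizing A (u ++ a ∷ [])
  synchronize-pair u {a} {x} {y} image-u δxa≡δya = δ x a , λ p →
    trans (run-++ u (a ∷ []) p) (to-δxa (x∈p∪q⁻ ⁅ x ⁆ ⁅ y ⁆ (proj₁ (image-u (run u p)) (p , refl))))
    where
    to-δxa : ∀ {r} → r ∈ ⁅ x ⁆ ⊎ r ∈ ⁅ y ⁆ → δ r a ≡ δ x a
    to-δxa (inj₁ r∈⁅x⁆) = cong (λ r → δ r a) (x∈⁅y⁆⇒x≡y x r∈⁅x⁆)
    to-δxa (inj₂ r∈⁅y⁆) = trans (cong (λ r → δ r a) (x∈⁅y⁆⇒x≡y y r∈⁅y⁆)) (sym δxa≡δya)

square-identity : ∀ n → 2 ≤ n → n * (n ∸ 2) + 1 ≡ (n ∸ 1) ^ 2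
square-identity (suc zero)    (s≤s ())
square-identity (suc (suc k)) _ = solve 1 (λ k → (con 2 :+ k) :* k :+ con 1 := (con 1 :+ k) :^ 2) refl k
  where open +-*-Solver

module CyclicCollection {n m} (A : DFA n m) (W : Fin n → Word m)
  (contracting : OneContractingCollection A W) (efficient : Efficient A W)
  (σ : Fin n → Fin n) (state-map : IsStateMap A W σ) (cyclic : IsCyclicPermutation σ) where
  open Words A

  fibre-contracting : ∀ q → fibre (run (W q)) (σ q) ≡ 2
  fibre-contracting q =
    trans (sym (length-filter-tabulate (λ p → run (W q) p ≟F σ q) (λ p → p))) (state-map q)

  extension-step : ∀ {q S} → q ∉ S → σ q ∈ S →
                   (∀ {s} → s ∈ S → InImage A (W q) s) × ∣ S ∣ < ∣ preimage (run (W q)) S ∣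
  extension-step {q} {S} q∉S σq∈S =
    covered , preimage-grows (run (W q)) S covered σq∈S (≤-reflexive (sym (fibre-contracting q)))
    where
    covered : ∀ {s} → s ∈ S → InImage A (W q) s
    covered s∈S = proj₂ (contracting q _) (λ s≡q → q∉S (subst (_∈ S) s≡q s∈S))

  extend : ∀ d (S : Subset n) → Nonempty S → n ≤ ∣ S ∣ + d →
           ∃ λ w → ImageIs A w S × length w ≤ n * d
  extend d S _ _ with all? (_∈? S)
  ... | yes full = [] , image-[] full , z≤n
  extend d S _ _ | no ¬full with ¬∀⟶∃¬ n (_∈ S) (_∈? S) ¬full
  extend zero S _ n≤∣S∣+0 | no _ | q₀ , q₀∉S =
    contradiction (subst (n ≤_) (+-identityʳ _) n≤∣S∣+0) (<⇒≱ (∣∣<n q₀∉S))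
  extend (suc d) S (s , s∈S) n≤∣S∣+d+1 | no _ | q₀ , q₀∉S
    with cyclic q₀ s
  ... | k , σᵏq₀≡s with exit-point σ S k q₀∉S (subst (_∈ S) (sym σᵏq₀≡s) s∈S)
  ... | q , q∉S , σq∈S with extension-step q∉S σq∈S
  ... | covered , grows with extend d (preimage (run (W q)) S) T-nonempty n≤∣T∣+d
    where
    T-nonempty : Nonempty (preimage (run (W q)) S)
    T-nonempty with covered s∈S
    ... | p , p↦s = p , ∈-preimage⁺ (subst (_∈ S) (sym p↦s) s∈S)

    n≤∣T∣+d : n ≤ ∣ preimage (run (W q)) S ∣ + d
    n≤∣T∣+d = ≤-trans n≤∣S∣+d+1 (≤-trans (≤-reflexive (+-suc ∣ S ∣ d)) (+-monoˡ-≤ d grows))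
  ... | u , image-u , u-short = u ++ W q , image-++ u (W q) image-u covered , length-bound
    where
    open ≤-Reasoning
    length-bound : length (u ++ W q) ≤ n * suc d
    length-bound = begin
      length (u ++ W q)       ≡⟨ length-++ u ⟩
      length u + length (W q) ≤⟨ +-mono-≤ u-short (efficient q) ⟩
      n * d + n               ≡⟨ +-comm (n * d) n ⟩
      n + n * d               ≡⟨ sym (*-suc n d) ⟩
      n * suc d               ∎

  image-of-size : ∀ (S : Subset n) k → ∣ S ∣ ≡ k → 1 ≤ k →
                  ∃[ w ] (ImageIs A w S × length w ≤ n * (n ∸ k))
  image-of-size S k ∣S∣≡k 1≤k =
    extend (n ∸ k) S (∣∣>0⇒nonempty S (subst (1 ≤_) (sym ∣S∣≡k) 1≤k))
      (subst (λ j → n ≤ j + (n ∸ k)) (sym ∣S∣≡k) (m≤n+m∸n n k))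

  synchronizing : Fin n → ∃[ w ] (Synchronizing A w × length w ≤ (n ∸ 1) ^ 2)
  synchronizing q
    with count-two-witnesses (λ p → run (W q) p ≟F σ q) (≤-reflexive (sym (fibre-contracting q)))
  ... | x , y , x≢y , x↦σq , y↦σq with merging-letter (W q) x≢y (trans x↦σq (sym y↦σq))
  ... | a , x′ , y′ , x′≢y′ , merged with extend (n ∸ 2) (⁅ x′ ⁆ ∪ ⁅ y′ ⁆) pair-nonempty n≤∣pair∣+n-2
    where
    pair-nonempty : Nonempty (⁅ x′ ⁆ ∪ ⁅ y′ ⁆)
    pair-nonempty = x′ , p⊆p∪q ⁅ y′ ⁆ (x∈⁅x⁆ x′)

    n≤∣pair∣+n-2 : n ≤ ∣ ⁅ x′ ⁆ ∪ ⁅ y′ ⁆ ∣ + (n ∸ 2)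
    n≤∣pair∣+n-2 = ≤-trans (m≤n+m∸n n 2) (+-monoˡ-≤ (n ∸ 2) (2≤∣pair∣ x′≢y′))
  ... | u , image-u , u-short = u ++ a ∷ [] , synchronize-pair u image-u merged , length-bound
    where
    open ≤-Reasoning
    length-bound : length (u ++ a ∷ []) ≤ (n ∸ 1) ^ 2
    length-bound = begin
      length (u ++ a ∷ [])  ≡⟨ length-++ u ⟩
      length u + 1          ≤⟨ +-monoˡ-≤ 1 u-short ⟩
      n * (n ∸ 2) + 1       ≡⟨ square-identity n (≤-trans (2≤∣pair∣ x′≢y′) (∣p∣≤n (⁅ x′ ⁆ ∪ ⁅ y′ ⁆))) ⟩
      (n ∸ 1) ^ 2           ∎

-- Both claims; the hypothesis 0 < n provides a state q with which to invoke claim (1).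
theorem2 : ∀ {n m : ℕ} (A : DFA n m) → 0 < n
    → (W : Fin n → Word m) → OneContractingCollection A W → Efficient A W
    → (σ : Fin n → Fin n) → IsStateMap A W σ → IsCyclicPermutation σ
    → (∃[ w ] (Synchronizing A w × length w ≤ (n ∸ 1) ^ 2))
      × (∀ (S : Subset n) (k : ℕ) → ∣ S ∣ ≡ k → 1 ≤ k
          → ∃[ w ] (ImageIs A w S × length w ≤ n * (n ∸ k)))
theorem2 {suc n} A _ W contracting efficient σ state-map cyclic =
  synchronizing zero , image-of-size
  where open CyclicCollection A W contracting efficient σ state-map cyclic
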